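{- Let $\mathcal{G}$ be an ordered group satisfying GOG1. For all $g,h\in\mathcal{G}$ with $g\prec h$, we have $gh\asymp hg\asymp h$.
   Context: An ordered group is a group $(\mathcal{G},\cdot,1)$ with a linear order $<$ such that $g>h$ implies $fg>fh$ and $gf>hf$ for all $f$. $\mathcal{C}(g)=\{h: hg=gh\}$, $\mathcal{G}^{>}=\{f: f>1\}$. GOG1: for all $f,g\in\mathcal{G}^{>}$ with $f\geqslant g$ and all $g_0\in\mathcal{C}(g)$ there is $f_0\in\mathcal{C}(f)$ with $f_0\geqslant g_0$. For $f,g\in\mathcal{G}$: $f\preccurlyeq g$ holds if $f=1$, or if $g\neq 1$ and there are $g_0,g_1\in\mathcal{C}(g)$ with $g_0\leqslant f\leqslant g_1$; $f\asymp g$ means $f\preccurlyeq g$ and $g\preccurlyeq f$; $f\prec g$ means $f\preccurlyeq g$ and not $g\preccurlyeq f$. -}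

module Defs where

open import Level using (Level; _⊔_; suc)
open import Algebra.Bundles using (Group)
open import Relation.Binary.Core using (Rel)
open import Relation.Binary.Structures using (IsTotalOrder)
open import Data.Product using (_×_; Σ; ∃; _,_)
open import Data.Sum using (_⊎_)
open import Relation.Nullary using (¬_)

record OrderedGroup (c ℓ₁ ℓ₂ : Level) : Set (suc (c ⊔ ℓ₁ ⊔ ℓ₂)) where
  field
    group : Group c ℓ₁
  open Group group public
  field
    _≤_         : Rel Carrier ℓ₂
    isTotalOrder : IsTotalOrder _≈_ _≤_

  _<_ : Rel Carrier (ℓ₁ ⊔ ℓ₂)
  x < y = (x ≤ y) × ¬ (x ≈ y)

  field
    compatˡ : ∀ f g h → h < g → (f ∙ h) < (f ∙ g)
    compatʳ : ∀ f g h → h < g → (h ∙ f) < (g ∙ f)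

module _ {c ℓ₁ ℓ₂ : Level} (G : OrderedGroup c ℓ₁ ℓ₂) where
  open OrderedGroup G

  _∈𝒞_ : Carrier → Carrier → Set ℓ₁
  h ∈𝒞 g = (h ∙ g) ≈ (g ∙ h)

  GOG1 : Set (c ⊔ ℓ₁ ⊔ ℓ₂)
  GOG1 = ∀ f g → ε < f → ε < g → g ≤ f →
         ∀ g₀ → g₀ ∈𝒞 g → Σ Carrier (λ f₀ → f₀ ∈𝒞 f × g₀ ≤ f₀)

  _≼_ : Rel Carrier (c ⊔ ℓ₁ ⊔ ℓ₂)
  f ≼ g = (f ≈ ε) ⊎
          (¬ (g ≈ ε) × Σ Carrier (λ g₀ → Σ Carrier (λ g₁ →
              g₀ ∈𝒞 g × g₁ ∈𝒞 g × g₀ ≤ f × f ≤ g₁)))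

  _≍_ : Rel Carrier (c ⊔ ℓ₁ ⊔ ℓ₂)
  f ≍ g = (f ≼ g) × (g ≼ f)

  _≺_ : Rel Carrier (c ⊔ ℓ₁ ⊔ ℓ₂)
  f ≺ g = (f ≼ g) × ¬ (g ≼ f)

{-# OPTIONS --safe #-}
-- Suppose h ⋠ g, so h ≠ 1; say h > 1.  Then h lies strictly above every
-- element commuting with g if g ≠ 1, and in any case above g, g⁻¹ and g⁻².  Hence
-- 1 < hg, 1 < gh and 1 < ghg, which give 1 < hg < h², 1 < h < (hg)² and
-- 1 < gh < h² < (hg)⁴, all bounds lying in the relevant centralisers.  The
-- missing bound hg ≼ gh is the bound gh ≼ hg in the opposite group, and the
-- case h < 1 is the case h > 1 for the reversed order.
module Submission where

open import Defs
open import Level using (Level)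
import Algebra.Construct.Flip.Op as Op
import Algebra.Properties.Group as GroupProperties
open import Data.Product using (_×_; _,_; proj₁; map; map₂)
open import Data.Sum using (inj₁; inj₂; [_,_]′)
open import Function using (id; _∘_; flip)
open import Relation.Binary.Bundles using (TotalOrder)
open import Relation.Binary.Structures using (IsTotalOrder)
import Relation.Binary.Construct.Flip.EqAndOrd as Flip
import Relation.Binary.Properties.Setoid as SetoidProperties
import Relation.Binary.Properties.TotalOrder as TotalOrderProperties
open import Relation.Nullary using (¬_)

private
  variable
    c ℓ₁ ℓ₂ : Level

≥-orderedGroup : OrderedGroup c ℓ₁ ℓ₂ → OrderedGroup c ℓ₁ ℓ₂
≥-orderedGroup G = record
  { group        = group
  ; _≤_          = flip _≤_
  ; isTotalOrder = Flip.isTotalOrder isTotalOrder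
  ; compatˡ      = λ f g h → map₂ ≉-sym ∘ compatˡ f h g ∘ map₂ ≉-sym
  ; compatʳ      = λ f g h → map₂ ≉-sym ∘ compatʳ f h g ∘ map₂ ≉-sym
  }
  where
  open OrderedGroup G
  open SetoidProperties setoid using (≉-sym)

opposite-orderedGroup : OrderedGroup c ℓ₁ ℓ₂ → OrderedGroup c ℓ₁ ℓ₂
opposite-orderedGroup G = record
  { group        = Op.group group
  ; _≤_          = _≤_
  ; isTotalOrder = isTotalOrder
  ; compatˡ      = compatʳ
  ; compatʳ      = compatˡ
  }
  where open OrderedGroup G

module _ (G : OrderedGroup c ℓ₁ ℓ₂) where
  open OrderedGroup G

  ≼⇒≼-≥ : ∀ {x y} → _≼_ G x y → _≼_ (≥-orderedGroup G) x y
  ≼⇒≼-≥ (inj₁ x≈ε) = inj₁ x≈ε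
  ≼⇒≼-≥ (inj₂ (y≉ε , y₀ , y₁ , y₀∈𝒞y , y₁∈𝒞y , y₀≤x , x≤y₁)) =
    inj₂ (y≉ε , y₁ , y₀ , y₁∈𝒞y , y₀∈𝒞y , x≤y₁ , y₀≤x)

  ≼⇒≼-opposite : ∀ {x y} → _≼_ G x y → _≼_ (opposite-orderedGroup G) x y
  ≼⇒≼-opposite (inj₁ x≈ε) = inj₁ x≈ε
  ≼⇒≼-opposite (inj₂ (y≉ε , y₀ , y₁ , y₀∈𝒞y , y₁∈𝒞y , bounds)) =
    inj₂ (y≉ε , y₀ , y₁ , sym y₀∈𝒞y , sym y₁∈𝒞y , bounds)

  private
    totalOrder : TotalOrder c ℓ₁ ℓ₂
    totalOrder = record { isTotalOrder = isTotalOrder }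

  open TotalOrder totalOrder using ()
    renaming (trans to ≤-trans; reflexive to ≤-reflexive)
  open TotalOrderProperties totalOrder using (≰⇒>; <⇒≱; <-trans; <-respˡ-≈; <-respʳ-≈)
  open GroupProperties group using (ε⁻¹≈ε; //-rightDividesˡ)

  <⇒≤ : ∀ {x y} → x < y → x ≤ y
  <⇒≤ = proj₁

  ε<⇒≉ε : ∀ {x} → ε < x → ¬ x ≈ ε
  ε<⇒≉ε (_ , ε≉x) = ε≉x ∘ sym

  ∙-mono-< : ∀ {x y u v} → x < y → u < v → (x ∙ u) < (y ∙ v)
  ∙-mono-< {x} {y} {u} {v} x<y u<v = <-trans (compatʳ u y x x<y) (compatˡ y v u u<v)

  ⁻¹<⇒ε<∙ˡ : ∀ {x y} → (x ⁻¹) < y → ε < (x ∙ y)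
  ⁻¹<⇒ε<∙ˡ {x} {y} x⁻¹<y = <-respˡ-≈ (inverseʳ x) (compatˡ x y (x ⁻¹) x⁻¹<y)

  ⁻¹<⇒ε<∙ʳ : ∀ {x y} → (x ⁻¹) < y → ε < (y ∙ x)
  ⁻¹<⇒ε<∙ʳ {x} {y} x⁻¹<y = <-respˡ-≈ (inverseˡ x) (compatʳ x y (x ⁻¹) x⁻¹<y)

  x∙y⁻¹<z⇒x<z∙y : ∀ {x y z} → (x ∙ y ⁻¹) < z → x < (z ∙ y)
  x∙y⁻¹<z⇒x<z∙y {x} {y} {z} x∙y⁻¹<z =
    <-respˡ-≈ (//-rightDividesˡ y x) (compatʳ y z (x ∙ y ⁻¹) x∙y⁻¹<z)

  ε∈𝒞 : ∀ x → _∈𝒞_ G ε x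
  ε∈𝒞 x = trans (identityˡ x) (sym (identityʳ x))

  ⁻¹∈𝒞 : ∀ x → _∈𝒞_ G (x ⁻¹) x
  ⁻¹∈𝒞 x = trans (inverseˡ x) (sym (inverseʳ x))

  ∙∈𝒞 : ∀ {a b x} → _∈𝒞_ G a x → _∈𝒞_ G b x → _∈𝒞_ G (a ∙ b) x
  ∙∈𝒞 {a} {b} {x} ax≈xa bx≈xb = begin
    (a ∙ b) ∙ x  ≈⟨ assoc a b x ⟩
    a ∙ (b ∙ x)  ≈⟨ ∙-congˡ bx≈xb ⟩
    a ∙ (x ∙ b)  ≈⟨ assoc a x b ⟨
    (a ∙ x) ∙ b  ≈⟨ ∙-congʳ ax≈xa ⟩
    (x ∙ a) ∙ b  ≈⟨ assoc x a b ⟩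
    x ∙ (a ∙ b)  ∎
    where open import Relation.Binary.Reasoning.Setoid setoid

  ≼-fromUpperBound : ∀ {x y z} → ε < y → _∈𝒞_ G z y → ε ≤ x → x ≤ z → _≼_ G x y
  ≼-fromUpperBound {y = y} ε<y z∈𝒞y ε≤x x≤z =
    inj₂ (ε<⇒≉ε ε<y , ε , _ , ε∈𝒞 y , z∈𝒞y , ε≤x , x≤z)

  -- When g ≈ ε, h ⋠ g says nothing about 𝒞(g); the last hypothesis then gives a ≈ ε < h.
  ⋠⇒∈𝒞-< : ∀ {a g h} → ε < h → ¬ _≼_ G h g → _∈𝒞_ G a g → (g ≈ ε → a ≈ ε) → a < h
  ⋠⇒∈𝒞-< {a} {g} {h} ε<h@(ε≤h , _) h⋠g a∈𝒞g a≈ε = ≰⇒> h≰a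
    where
    h≰a : ¬ h ≤ a
    h≰a h≤a = h⋠g (inj₂ (g≉ε , ε , a , ε∈𝒞 g , a∈𝒞g , ε≤h , h≤a))
      where
      g≉ε : ¬ g ≈ ε
      g≉ε g≈ε = <⇒≱ ε<h (≤-trans h≤a (≤-reflexive (a≈ε g≈ε)))

  ⋠⇒≼-positive : ∀ {g h} → ε < h → ¬ _≼_ G h g →
                 _≼_ G (g ∙ h) (h ∙ g) × _≍_ G (h ∙ g) h
  ⋠⇒≼-positive {g} {h} ε<h h⋠g = gh≼hg , hg≼h , h≼hg
    where
    g⁻¹≈ε : g ≈ ε → g ⁻¹ ≈ ε
    g⁻¹≈ε g≈ε = trans (⁻¹-cong g≈ε) ε⁻¹≈ε

    g<h : g < h
    g<h = ⋠⇒∈𝒞-< ε<h h⋠g refl id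

    g⁻¹<h : (g ⁻¹) < h
    g⁻¹<h = ⋠⇒∈𝒞-< ε<h h⋠g (⁻¹∈𝒞 g) g⁻¹≈ε

    g⁻¹g⁻¹<h : (g ⁻¹ ∙ g ⁻¹) < h
    g⁻¹g⁻¹<h = ⋠⇒∈𝒞-< ε<h h⋠g (∙∈𝒞 (⁻¹∈𝒞 g) (⁻¹∈𝒞 g))
                 (λ g≈ε → trans (∙-cong (g⁻¹≈ε g≈ε) (g⁻¹≈ε g≈ε)) (identityˡ ε))

    ε<hg : ε < (h ∙ g)
    ε<hg = ⁻¹<⇒ε<∙ʳ g⁻¹<h

    ε<gh : ε < (g ∙ h)
    ε<gh = ⁻¹<⇒ε<∙ˡ g⁻¹<h

    ε<ghg : ε < (g ∙ (h ∙ g))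
    ε<ghg = ⁻¹<⇒ε<∙ˡ (x∙y⁻¹<z⇒x<z∙y g⁻¹g⁻¹<h)

    h<hghg : h < ((h ∙ g) ∙ (h ∙ g))
    h<hghg = <-respʳ-≈ (sym (assoc h g (h ∙ g)))
               (<-respˡ-≈ (identityʳ h) (compatˡ h (g ∙ (h ∙ g)) ε ε<ghg))

    hghg∈𝒞hg : _∈𝒞_ G ((h ∙ g) ∙ (h ∙ g)) (h ∙ g)
    hghg∈𝒞hg = ∙∈𝒞 refl refl

    gh<hghghghg : (g ∙ h) < (((h ∙ g) ∙ (h ∙ g)) ∙ ((h ∙ g) ∙ (h ∙ g)))
    gh<hghghghg = <-trans (compatʳ h h g g<h) (∙-mono-< h<hghg h<hghg)

    gh≼hg : _≼_ G (g ∙ h) (h ∙ g)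
    gh≼hg = ≼-fromUpperBound ε<hg (∙∈𝒞 hghg∈𝒞hg hghg∈𝒞hg) (<⇒≤ ε<gh) (<⇒≤ gh<hghghghg)

    hg≼h : _≼_ G (h ∙ g) h
    hg≼h = ≼-fromUpperBound ε<h (∙∈𝒞 refl refl) (<⇒≤ ε<hg) (<⇒≤ (compatˡ h h g g<h))

    h≼hg : _≼_ G h (h ∙ g)
    h≼hg = ≼-fromUpperBound ε<hg hghg∈𝒞hg (<⇒≤ ε<h) (<⇒≤ h<hghg)

module _ (G : OrderedGroup c ℓ₁ ℓ₂) where
  open OrderedGroup G

  ⋠⇒≍-positive : ∀ {g h} → ε < h → ¬ _≼_ G h g →
                 _≍_ G (g ∙ h) (h ∙ g) × _≍_ G (h ∙ g) h
  ⋠⇒≍-positive ε<h h⋠g =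
    let gh≼hg , hg≍h = ⋠⇒≼-positive G ε<h h⋠g
        hg≼gh , _    = ⋠⇒≼-positive Gᵒᵖ ε<h (h⋠g ∘ ≼⇒≼-opposite Gᵒᵖ)
    in (gh≼hg , ≼⇒≼-opposite Gᵒᵖ hg≼gh) , hg≍h
    where
    Gᵒᵖ : OrderedGroup c ℓ₁ ℓ₂
    Gᵒᵖ = opposite-orderedGroup G

module _ (G : OrderedGroup c ℓ₁ ℓ₂) where
  open OrderedGroup G
  open IsTotalOrder isTotalOrder using (total)

  ⋠⇒≍ : ∀ {g h} → ¬ _≼_ G h g → _≍_ G (g ∙ h) (h ∙ g) × _≍_ G (h ∙ g) h
  ⋠⇒≍ {g} {h} h⋠g = [ positive , ≍-from-≥ ∘ negative ]′ (total ε h)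
    where
    ε≉h : ¬ ε ≈ h
    ε≉h = h⋠g ∘ inj₁ ∘ sym

    positive : ε ≤ h → _≍_ G (g ∙ h) (h ∙ g) × _≍_ G (h ∙ g) h
    positive ε≤h = ⋠⇒≍-positive G (ε≤h , ε≉h) h⋠g

    G≥ : OrderedGroup c ℓ₁ ℓ₂
    G≥ = ≥-orderedGroup G

    negative : h ≤ ε → _≍_ G≥ (g ∙ h) (h ∙ g) × _≍_ G≥ (h ∙ g) h
    negative h≤ε = ⋠⇒≍-positive G≥ (h≤ε , ε≉h) (h⋠g ∘ ≼⇒≼-≥ G≥)

    ≍-from-≥ : ∀ {x y u v} → _≍_ G≥ x y × _≍_ G≥ u v → _≍_ G x y × _≍_ G u v
    ≍-from-≥ = map (map (≼⇒≼-≥ G≥) (≼⇒≼-≥ G≥)) (map (≼⇒≼-≥ G≥) (≼⇒≼-≥ G≥))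

proposition2p5 : ∀ {c ℓ₁ ℓ₂ : Level} (G : OrderedGroup c ℓ₁ ℓ₂) → GOG1 G →
    ∀ g h → _≺_ G g h →
    _≍_ G (OrderedGroup._∙_ G g h) (OrderedGroup._∙_ G h g) ×
    _≍_ G (OrderedGroup._∙_ G h g) h
proposition2p5 G _ g h (_ , h⋠g) = ⋠⇒≍ G h⋠g
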